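{- Let $M[Q]$ be a generalized Catalan matroid of rank $r$ and corank $m$ with $m\ge r\ge 2$, having neither a loop nor an isthmus. Then for every pair of adjacent bases $B_1,B_2$ of $\operatorname{BG}(M[Q])$, there are at least $r-1$ distinct good cycles for $B_1B_2$.
   Context: Lattice paths go from $(0,0)$ to $(m,r)$ using steps $E=(1,0)$ and $N=(0,1)$, and are written as words of length $m+r$ over $\{E,N\}$. Given such a path $Q$, the generalized Catalan matroid $M[Q]$ is the matroid on ground set $[m+r]=\{1,\dots,m+r\}$ whose bases are the sets $B=\{j : \text{the $j$th step of } L \text{ is } N\}$ for the lattice paths $L$ from $(0,0)$ to $(m,r)$ that never go above $Q$ (equivalently, for each $i$, the $i$th $N$ step of $L$ occurs at a position no earlier than the $i$th $N$ step of $Q$). It has rank $r$ and corank $m$. For a matroid $M$, its basis graph $\operatorname{BG}(M)$ has the bases of $M$ as vertices, two bases $B,B'$ being adjacent if and only if $|B\triangle B'|=2$. For adjacent bases $B_1,B_2$ with $B_1\setminus B_2=\{e\}$, a good cycle for $B_1B_2$ is a sequence of four distinct bases $B_1B_2B_3B_4$ forming a cycle in $\operatorname{BG}(M)$ (so that $B_2B_3$, $B_3B_4$ and $B_4B_1$ are edges) such that $e\in B_4$ and $e\notin B_3$. -}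

module Defs where

open import Data.Nat using (ℕ; zero; suc; _+_; _≤_)
open import Data.Bool using (Bool; true; false)
open import Data.Fin using (Fin)
open import Data.Vec using (Vec; []; _∷_)
open import Data.Fin.Subset using (Subset; _∈_; _∉_; _∪_; _─_; ∣_∣)
open import Data.Product using (_×_)
open import Relation.Binary.PropositionalEquality using (_≡_; _≢_)

-- A lattice path of length n is a word over {E,N}; we encode it as a
-- subset of Fin n (= Vec Bool n): position j is `true` (inside) iff the
-- j-th step is N.

prefixN : ∀ {n} → Subset n → ℕ → ℕ
prefixN []       _       = 0
prefixN (x ∷ xs) zero    = 0
prefixN (true  ∷ xs) (suc k) = suc (prefixN xs k)
prefixN (false ∷ xs) (suc k) = prefixN xs k

NeverAbove : ∀ {n} → Subset n → Subset n → Set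
NeverAbove L Q = ∀ k → prefixN L k ≤ prefixN Q k

IsPath : (m r : ℕ) → Subset (m + r) → Set
IsPath m r P = ∣ P ∣ ≡ r

-- bases of the generalized Catalan matroid M[Q]: N-position sets of the
-- lattice paths L from (0,0) to (m,r) never going above Q
IsBasis : (m r : ℕ) → Subset (m + r) → Subset (m + r) → Set
IsBasis m r Q B = IsPath m r B × NeverAbove B Q

HasLoop : (m r : ℕ) → Subset (m + r) → Set
HasLoop m r Q = Data.Product.Σ (Fin (m + r)) λ e →
  ∀ B → IsBasis m r Q B → e ∉ B

HasIsthmus : (m r : ℕ) → Subset (m + r) → Set
HasIsthmus m r Q = Data.Product.Σ (Fin (m + r)) λ e →
  ∀ B → IsBasis m r Q B → e ∈ B

Adjacent : ∀ {n} → Subset n → Subset n → Set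
Adjacent B B' = ∣ (B ─ B') ∪ (B' ─ B) ∣ ≡ 2

-- (B3 , B4) gives a good cycle B1 B2 B3 B4 for the edge B1B2:
-- B3, B4 are bases, the four bases are distinct, B2B3, B3B4, B4B1 are edges,
-- and the element e of B1 ∖ B2 satisfies e ∈ B4, e ∉ B3.
GoodCycle : (m r : ℕ) → Subset (m + r) →
  (B1 B2 B3 B4 : Subset (m + r)) → Set
GoodCycle m r Q B1 B2 B3 B4 =
  IsBasis m r Q B3 × IsBasis m r Q B4 ×
  B1 ≢ B2 × B1 ≢ B3 × B1 ≢ B4 × B2 ≢ B3 × B2 ≢ B4 × B3 ≢ B4 ×
  Adjacent B2 B3 × Adjacent B3 B4 × Adjacent B4 B1 ×
  (∀ e → e ∈ B1 → e ∉ B2 → (e ∈ B4 × e ∉ B3))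

module Submission where

-- Write B1 = B ∪ {e} and B2 = B ∪ {f}, and read a basis as a lattice path through its prefix
-- counts of N steps, which may never exceed those of Q; a path is tight at k when its count
-- equals Q's there. Moving the N step at g of a path to an earlier position h keeps it below Q
-- iff it was strictly below Q at every k in (h, g]. Having no loop and no isthmus, Q starts
-- with N and ends with E. Let gmin be the least element of B and hmax the largest element
-- outside B1 ∪ B2.
-- If B1 is tight at some k in (0, gmin], then B2 is nowhere tight after hmax, and every g ∈ B
-- gives the good cycle B3 = B2 - g + hmax, B4 = B1 - g + hmax (B4 = B2 - g + e instead when B1
-- is tight somewhere in (hmax, g]). Otherwise every h ∉ B1 ∪ B2 gives the good cycle
-- B3 = B2 - gmin + h, B4 = B1 - gmin + h (B3 = B2 - f + h instead when f < gmin). The cycles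
-- are told apart by g, resp. h, so there are r - 1, resp. m - 1 ≥ r - 1, of them.

open import Defs
open import Data.Nat
  using (ℕ; zero; suc; _+_; _∸_; _≤_; _<_; z≤n; s≤s; _≤′_; ≤′-refl; ≤′-step; _≟_; _<?_; _≤?_)
open import Data.Nat.Properties
open import Algebra.Properties.CommutativeSemigroup +-commutativeSemigroup using (interchange)
open import Data.Bool using (Bool; true; false; _∧_; _∨_; _xor_; not; if_then_else_)
open import Data.Vec using ([]; _∷_)
open import Data.Vec.Base using (here; there)
open import Data.Fin using (toℕ; fromℕ<) renaming (zero to fzero; suc to fsuc)
open import Data.Fin.Properties using (toℕ-fromℕ<)
open import Data.Fin.Subset using (Subset; _∈_; _∉_; _∪_; _─_; ∣_∣)
open import Data.Product using (Σ; ∃-syntax; _×_; _,_; proj₁; proj₂)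
open import Data.Sum using (_⊎_; inj₁; inj₂)
open import Data.Empty using (⊥)
open import Data.List using (List; []; _∷_; length)
open import Data.List.Relation.Unary.All using (All; []; _∷_)
open import Data.List.Relation.Unary.AllPairs using ([]; _∷_)
open import Data.List.Relation.Unary.Unique.Propositional using (Unique)
open import Relation.Nullary using (¬_; Dec; yes; no; does; contradiction)
open import Relation.Nullary.Decidable using (dec-true; dec-false; map′; _×-dec_; _⊎-dec_)
open import Relation.Binary.PropositionalEquality
open import Relation.Binary.Definitions using (tri<; tri≈; tri>)
open import Data.Bool.Properties using (¬-not; xor-same)
open import Function using (_∘′_)

∧-true : ∀ {x y} → x ∧ y ≡ true → x ≡ true × y ≡ true
∧-true {true} {true} _ = refl , refl

nor-true : ∀ {x y} → not (x ∨ y) ≡ true → x ≡ false × y ≡ false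
nor-true {false} {false} _ = refl , refl

not-true : ∀ {x} → not x ≡ true → x ≡ false
not-true {false} _ = refl

true≢false : ∀ {x y : Bool} → x ≡ true → y ≡ false → x ≢ y
true≢false refl refl ()

bit : Bool → ℕ
bit true  = 1
bit false = 0

count : (ℕ → Bool) → ℕ → ℕ
count p zero    = 0
count p (suc k) = count p k + bit (p k)

point : ℕ → ℕ → Bool
point a j = does (a ≟ j)

point-self : ∀ a → point a a ≡ true
point-self a = dec-true (a ≟ a) refl

point-other : ∀ {a j} → a ≢ j → point a j ≡ false
point-other {a} {j} = dec-false (a ≟ j)

restrict : ∀ {P : ℕ → Set} {k} → (∀ j → j < suc k → P j) → ∀ j → j < k → P j
restrict h j j<k = h j (m<n⇒m<1+n j<k)

count-cong : ∀ {p q} k → (∀ j → j < k → p j ≡ q j) → count p k ≡ count q k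
count-cong zero    p≗q = refl
count-cong (suc k) p≗q = cong₂ _+_ (count-cong k (restrict p≗q)) (cong bit (p≗q k ≤-refl))

count-mono : ∀ {p q} k → (∀ j → j < k → p j ≡ true → q j ≡ true) → count p k ≤ count q k
count-mono zero    p⊆q = z≤n
count-mono {p} {q} (suc k) p⊆q = +-mono-≤ (count-mono k (restrict p⊆q)) (bit-mono (p⊆q k ≤-refl))
  where
  bit-mono : ∀ {x y} → (x ≡ true → y ≡ true) → bit x ≤ bit y
  bit-mono {false} _   = z≤n
  bit-mono {true}  x⇒y rewrite x⇒y refl = ≤-refl

count-monoʳ : ∀ p {k k'} → k ≤ k' → count p k ≤ count p k'
count-monoʳ p k≤k' = go (≤⇒≤′ k≤k')
  where
  go : ∀ {k k'} → k ≤′ k' → count p k ≤ count p k'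
  go ≤′-refl        = ≤-refl
  go (≤′-step k≤k') = ≤-trans (go k≤k') (m≤m+n _ _)

count-≥1 : ∀ p {i k} → i < k → p i ≡ true → 1 ≤ count p k
count-≥1 p {i} i<k pi =
  ≤-trans (subst (λ b → 1 ≤ count p i + bit b) (sym pi) (m≤n+m 1 _)) (count-monoʳ p i<k)

count-≥2 : ∀ p {i j k} → i < j → j < k → p i ≡ true → p j ≡ true → 2 ≤ count p k
count-≥2 p i<j j<k pi pj =
  ≤-trans (+-mono-≤ (count-≥1 p i<j pi) (subst (λ b → 1 ≤ bit b) (sym pj) ≤-refl))
          (count-monoʳ p j<k)

count-none : ∀ p k → (∀ j → j < k → p j ≡ false) → count p k ≡ 0
count-none p zero    none = refl
count-none p (suc k) none = cong₂ _+_ (count-none p k (restrict none)) (cong bit (none k ≤-refl))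

count-false : ∀ k → count (λ _ → false) k ≡ 0
count-false k = count-none (λ _ → false) k λ _ _ → refl

count-balance : ∀ p p' q q' k →
  (∀ j → j < k → bit (p j) + bit (p' j) ≡ bit (q j) + bit (q' j)) →
  count p k + count p' k ≡ count q k + count q' k
count-balance p p' q q' zero    _  = refl
count-balance p p' q q' (suc k) pw = begin
  (count p k + bit (p k)) + (count p' k + bit (p' k))
    ≡⟨ interchange (count p k) (bit (p k)) (count p' k) (bit (p' k)) ⟩
  (count p k + count p' k) + (bit (p k) + bit (p' k))
    ≡⟨ cong₂ _+_ (count-balance p p' q q' k (restrict pw)) (pw k ≤-refl) ⟩
  (count q k + count q' k) + (bit (q k) + bit (q' k))
    ≡⟨ interchange (count q k) (count q' k) (bit (q k)) (bit (q' k)) ⟩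
  (count q k + bit (q k)) + (count q' k + bit (q' k)) ∎
  where open ≡-Reasoning

count-sum : ∀ p q q' k → (∀ j → j < k → bit (p j) ≡ bit (q j) + bit (q' j)) →
  count p k ≡ count q k + count q' k
count-sum p q q' k pw = begin
  count p k                            ≡⟨ sym (+-identityʳ _) ⟩
  count p k + 0                        ≡⟨ cong (count p k +_) (sym (count-false k)) ⟩
  count p k + count (λ _ → false) k    ≡⟨ count-balance p (λ _ → false) q q' k pw′ ⟩
  count q k + count q' k               ∎
  where
  open ≡-Reasoning
  pw′ : ∀ j → j < k → bit (p j) + 0 ≡ bit (q j) + bit (q' j)
  pw′ j j<k = trans (+-identityʳ _) (pw j j<k)

count-complement : ∀ p k → count p k + count (λ j → not (p j)) k ≡ k
count-complement p zero    = refl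
count-complement p (suc k) = begin
  (count p k + bit (p k)) + (count p̅ k + bit (p̅ k))
    ≡⟨ interchange (count p k) (bit (p k)) (count p̅ k) (bit (p̅ k)) ⟩
  (count p k + count p̅ k) + (bit (p k) + bit (p̅ k))
    ≡⟨ cong₂ _+_ (count-complement p k) (bit-excluded-middle (p k)) ⟩
  k + 1                                             ≡⟨ +-comm k 1 ⟩
  suc k                                             ∎
  where
  open ≡-Reasoning
  p̅ : ℕ → Bool
  p̅ j = not (p j)
  bit-excluded-middle : ∀ x → bit x + bit (not x) ≡ 1
  bit-excluded-middle true  = refl
  bit-excluded-middle false = refl

count-point-≤ : ∀ a k → k ≤ a → count (point a) k ≡ 0
count-point-≤ a k k≤a = count-none (point a) k λ j j<k →
  point-other λ a≡j → <⇒≱ j<k (subst (k ≤_) a≡j k≤a)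

count-point-< : ∀ a k → a < k → count (point a) k ≡ 1
count-point-< a (suc k) a<1+k with a ≟ k
... | yes refl = cong₂ _+_ (count-point-≤ a a ≤-refl) (cong bit (point-self a))
... | no  a≢k  =
  cong₂ _+_ (count-point-< a k (≤∧≢⇒< (≤-pred a<1+k) a≢k)) (cong bit (point-other a≢k))

count-point-≤1 : ∀ a k → count (point a) k ≤ 1
count-point-≤1 a k with k ≤? a
... | yes k≤a = ≤-trans (≤-reflexive (count-point-≤ a k k≤a)) z≤n
... | no  k≰a = ≤-reflexive (count-point-< a k (≰⇒> k≰a))

count-≤1 : ∀ p a k → (∀ j → j < k → p j ≡ true → j ≡ a) → count p k ≤ 1
count-≤1 p a k only-a =
  ≤-trans (count-mono k λ j j<k pj → subst (λ i → point a i ≡ true) (sym (only-a j j<k pj)) (point-self a))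
          (count-point-≤1 a k)

count-min : ∀ p k → 1 ≤ count p k →
  ∃[ j ] (j < k × p j ≡ true × ∀ i → i < j → p i ≡ false)
count-min p (suc k) 1≤c with 1 ≤? count p k
... | yes 1≤c' = let j , j<k , pj , minimal = count-min p k 1≤c' in
  j , m<n⇒m<1+n j<k , pj , minimal
... | no  1≰c' with p k in pk
...   | true  = k , ≤-refl , pk , λ i i<k → ¬-not λ pi → 1≰c' (count-≥1 p i<k pi)
...   | false = contradiction (subst (1 ≤_) (+-identityʳ _) 1≤c) 1≰c'

count-max : ∀ p k → 1 ≤ count p k →
  ∃[ j ] (j < k × p j ≡ true × ∀ i → j < i → i < k → p i ≡ false)
count-max p (suc k) 1≤c with p k in pk
... | true  = k , ≤-refl , pk , λ i k<i i<1+k → contradiction (≤-pred i<1+k) (<⇒≱ k<i)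
... | false =
  let j , j<k , pj , maximal = count-max p k (subst (1 ≤_) (+-identityʳ _) 1≤c) in
  j , m<n⇒m<1+n j<k , pj , maximal′ maximal
  where
  maximal′ : ∀ {j} → (∀ i → j < i → i < k → p i ≡ false) →
    ∀ i → j < i → i < suc k → p i ≡ false
  maximal′ maximal i j<i i<1+k with i ≟ k
  ... | yes refl = pk
  ... | no  i≢k  = maximal i j<i (≤∧≢⇒< (≤-pred i<1+k) i≢k)

countFrom : (ℕ → Bool) → ℕ → ℕ → ℕ
countFrom p k n = count (λ t → p (k + t)) (n ∸ k)

count-+ : ∀ p k d → count p (k + d) ≡ count p k + count (λ t → p (k + t)) d
count-+ p k zero    = trans (cong (count p) (+-identityʳ k)) (sym (+-identityʳ _))
count-+ p k (suc d) = begin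
  count p (k + suc d)                                  ≡⟨ cong (count p) (+-suc k d) ⟩
  count p (k + d) + bit (p (k + d))                    ≡⟨ cong (_+ bit (p (k + d))) (count-+ p k d) ⟩
  (count p k + count (λ t → p (k + t)) d) + bit (p (k + d)) ≡⟨ +-assoc (count p k) _ _ ⟩
  count p k + count (λ t → p (k + t)) (suc d)          ∎
  where open ≡-Reasoning

count-split : ∀ p {k n} → k ≤ n → count p n ≡ count p k + countFrom p k n
count-split p {k} {n} k≤n = trans (cong (count p) (sym (m+[n∸m]≡n k≤n))) (count-+ p k (n ∸ k))

shifted-< : ∀ {k n t} → t < n ∸ k → k + t < n
shifted-< {k} {n} {t} t<n∸k = subst (k + t <_) (m+[n∸m]≡n (<⇒≤ k<n)) (+-monoʳ-< k t<n∸k)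
  where
  k<n : k < n
  k<n = m∸n≢0⇒n<m λ n∸k≡0 → n≮0 (subst (t <_) n∸k≡0 t<n∸k)

shift-index : ∀ (p : ℕ → Bool) {k j} → k ≤ j → p j ≡ true → p (k + (j ∸ k)) ≡ true
shift-index p k≤j pj = subst (λ i → p i ≡ true) (sym (m+[n∸m]≡n k≤j)) pj

countFrom-≥1 : ∀ p {k j n} → k ≤ j → j < n → p j ≡ true → 1 ≤ countFrom p k n
countFrom-≥1 p {k} k≤j j<n pj =
  count-≥1 (λ t → p (k + t)) (∸-monoˡ-< j<n k≤j) (shift-index p k≤j pj)

countFrom-≥2 : ∀ p {k i j n} → k ≤ i → i < j → j < n → p i ≡ true → p j ≡ true →
  2 ≤ countFrom p k n
countFrom-≥2 p {k} {i} {j} k≤i i<j j<n pi pj =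
  count-≥2 (λ t → p (k + t)) (∸-monoˡ-< i<j k≤i) (∸-monoˡ-< j<n k≤j)
    (shift-index p k≤i pi) (shift-index p k≤j pj)
  where
  k≤j : k ≤ j
  k≤j = ≤-trans k≤i (<⇒≤ i<j)

countFrom-none : ∀ p {k n} → (∀ j → k ≤ j → j < n → p j ≡ false) → countFrom p k n ≡ 0
countFrom-none p {k} {n} none =
  count-none _ (n ∸ k) λ t t<n∸k → none (k + t) (m≤m+n k t) (shifted-< t<n∸k)

countFrom-≤1 : ∀ p a {k n} → (∀ j → k ≤ j → j < n → p j ≡ true → j ≡ a) → countFrom p k n ≤ 1
countFrom-≤1 p a {k} {n} only-a = count-≤1 _ (a ∸ k) (n ∸ k) λ t t<n∸k pt →
  trans (sym (m+n∸m≡n k t)) (cong (_∸ k) (only-a (k + t) (m≤m+n k t) (shifted-< t<n∸k) pt))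

+-double-injective : ∀ x y → x + x ≡ y + y → x ≡ y
+-double-injective zero    zero    _ = refl
+-double-injective (suc x) (suc y) eq = cong suc (+-double-injective x y
  (suc-injective (trans (sym (+-suc x x)) (trans (suc-injective eq) (+-suc y y)))))

at : ∀ {n} → Subset n → ℕ → Bool
at []       _       = false
at (x ∷ xs) zero    = x
at (x ∷ xs) (suc j) = at xs j

at-beyond : ∀ {n} (X : Subset n) {j} → n ≤ j → at X j ≡ false
at-beyond []                         _         = refl
at-beyond (x ∷ X) {suc j} (s≤s n≤j) = at-beyond X n≤j

count-at-∷ : ∀ {n} x (X : Subset n) k → count (at (x ∷ X)) (suc k) ≡ bit x + count (at X) k
count-at-∷ x X k = count-+ (at (x ∷ X)) 1 k

prefixN-count : ∀ {n} (X : Subset n) k → prefixN X k ≡ count (at X) k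
prefixN-count []           k       = sym (count-false k)
prefixN-count (x ∷ X)      zero    = refl
prefixN-count (true  ∷ X)  (suc k) = trans (cong suc (prefixN-count X k)) (sym (count-at-∷ true X k))
prefixN-count (false ∷ X)  (suc k) = trans (prefixN-count X k) (sym (count-at-∷ false X k))

card-count : ∀ {n} (X : Subset n) → ∣ X ∣ ≡ count (at X) n
card-count []                = refl
card-count {suc n} (true  ∷ X) = trans (cong suc (card-count X)) (sym (count-at-∷ true X n))
card-count {suc n} (false ∷ X) = trans (card-count X) (sym (count-at-∷ false X n))

∈⇒at : ∀ {n} {X : Subset n} {x} → x ∈ X → at X (toℕ x) ≡ true
∈⇒at here      = refl
∈⇒at (there p) = ∈⇒at p

at⇒∈ : ∀ {n} (X : Subset n) x → at X (toℕ x) ≡ true → x ∈ X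
at⇒∈ (true ∷ X) fzero    refl = here
at⇒∈ (_    ∷ X) (fsuc x) p    = there (at⇒∈ X x p)

at⇒∉ : ∀ {n} (X : Subset n) x → at X (toℕ x) ≡ false → x ∉ X
at⇒∉ X x p x∈X with trans (sym (∈⇒at x∈X)) p
... | ()

at-symdiff : ∀ {n} (X Y : Subset n) j → at ((X ─ Y) ∪ (Y ─ X)) j ≡ at X j xor at Y j
at-symdiff []          []          j       = refl
at-symdiff (true  ∷ X) (true  ∷ Y) zero    = refl
at-symdiff (true  ∷ X) (false ∷ Y) zero    = refl
at-symdiff (false ∷ X) (true  ∷ Y) zero    = refl
at-symdiff (false ∷ X) (false ∷ Y) zero    = refl
at-symdiff (_     ∷ X) (_     ∷ Y) (suc j) = at-symdiff X Y j

card-symdiff : ∀ {n} (X Y : Subset n) →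
  ∣ (X ─ Y) ∪ (Y ─ X) ∣ ≡ count (λ j → at X j xor at Y j) n
card-symdiff {n} X Y = trans (card-count ((X ─ Y) ∪ (Y ─ X))) (count-cong n λ j _ → at-symdiff X Y j)

member≢nonmember : ∀ {n} {X : Subset n} {a b} → at X a ≡ true → at X b ≡ false → a ≢ b
member≢nonmember Xa Xb refl with trans (sym Xa) Xb
... | ()

≢-at : ∀ {n} {X Y : Subset n} j → at X j ≢ at Y j → X ≢ Y
≢-at j Xj≢Yj refl = Xj≢Yj refl

record Exchange {n} (X Y : Subset n) : Set where
  field
    out new : ℕ
    out<n   : out < n
    new<n   : new < n
    out∈X   : at X out ≡ true
    out∉Y   : at Y out ≡ false
    new∉X   : at X new ≡ false
    new∈Y   : at Y new ≡ true
    agree   : ∀ j → j ≢ out → j ≢ new → at X j ≡ at Y j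

  out≢new : out ≢ new
  out≢new = member≢nonmember {X = X} out∈X new∉X

  X≢Y : X ≢ Y
  X≢Y = ≢-at out (true≢false out∈X out∉Y)

  only-out : ∀ {j} → at X j ≡ true → at Y j ≡ false → j ≡ out
  only-out {j} Xj Yj with j ≟ out | j ≟ new
  ... | yes j≡out | _         = j≡out
  ... | no  _     | yes refl  = contradiction (trans (sym Xj) new∉X) λ ()
  ... | no  j≢out | no  j≢new = contradiction (trans (sym Xj) (trans (agree j j≢out j≢new) Yj)) λ ()

  count-exchange : ∀ k → count (at Y) k + count (point out) k ≡ count (at X) k + count (point new) k
  count-exchange k = count-balance _ _ _ _ k λ j _ → pointwise j
    where
    pointwise : ∀ j → bit (at Y j) + bit (point out j) ≡ bit (at X j) + bit (point new j)
    pointwise j with out ≟ j | new ≟ j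
    ... | yes o≡j  | yes n≡j  = contradiction (trans o≡j (sym n≡j)) out≢new
    ... | yes refl | no  n≢j
      rewrite out∈X | out∉Y | point-self out | point-other n≢j = refl
    ... | no  o≢j  | yes refl
      rewrite new∉X | new∈Y | point-self new | point-other o≢j = refl
    ... | no  o≢j  | no  n≢j
      rewrite point-other o≢j | point-other n≢j | agree j (o≢j ∘′ sym) (n≢j ∘′ sym) = refl

  adjacent : Adjacent X Y
  adjacent = trans (card-symdiff X Y) (begin
    count (λ j → at X j xor at Y j) n
      ≡⟨ count-sum _ _ _ n (λ j _ → pointwise j) ⟩
    count (point out) n + count (point new) n
      ≡⟨ cong₂ _+_ (count-point-< out n out<n) (count-point-< new n new<n) ⟩
    2 ∎)
    where
    open ≡-Reasoning
    pointwise : ∀ j → bit (at X j xor at Y j) ≡ bit (point out j) + bit (point new j)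
    pointwise j with out ≟ j | new ≟ j
    ... | yes o≡j  | yes n≡j  = contradiction (trans o≡j (sym n≡j)) out≢new
    ... | yes refl | no  n≢j
      rewrite out∈X | out∉Y | point-self out | point-other n≢j = refl
    ... | no  o≢j  | yes refl
      rewrite new∉X | new∈Y | point-self new | point-other o≢j = refl
    ... | no  o≢j  | no  n≢j
      rewrite point-other o≢j | point-other n≢j | agree j (o≢j ∘′ sym) (n≢j ∘′ sym)
      = cong bit (xor-same (at Y j))

  count-both : ∀ k → count (at X) k ≡ count (λ j → at X j ∧ at Y j) k + count (point out) k
  count-both k = count-sum _ _ _ k λ j _ → pointwise j
    where
    pointwise : ∀ j → bit (at X j) ≡ bit (at X j ∧ at Y j) + bit (point out j)
    pointwise j with out ≟ j
    ... | yes refl rewrite out∈X | out∉Y | point-self out = refl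
    ... | no  o≢j rewrite point-other o≢j with j ≟ new
    ...   | yes refl rewrite new∉X = refl
    ...   | no  j≢new rewrite agree j (o≢j ∘′ sym) j≢new with at Y j
    ...     | true  = refl
    ...     | false = refl

  count-either : ∀ k → count (λ j → at X j ∨ at Y j) k ≡ count (at X) k + count (point new) k
  count-either k = count-sum _ _ _ k λ j _ → pointwise j
    where
    pointwise : ∀ j → bit (at X j ∨ at Y j) ≡ bit (at X j) + bit (point new j)
    pointwise j with new ≟ j
    ... | yes refl rewrite new∉X | new∈Y | point-self new = refl
    ... | no  n≢j rewrite point-other n≢j with j ≟ out
    ...   | yes refl rewrite out∈X = refl
    ...   | no  j≢out rewrite agree j j≢out (n≢j ∘′ sym) with at Y j
    ...     | true  = refl
    ...     | false = refl

exchange-sym : ∀ {n} {X Y : Subset n} → Exchange X Y → Exchange Y X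
exchange-sym ex = record
  { out = new ; new = out ; out<n = new<n ; new<n = out<n
  ; out∈X = new∈Y ; out∉Y = new∉X ; new∉X = out∉Y ; new∈Y = out∈X
  ; agree = λ j j≢new j≢out → sym (agree j j≢out j≢new)
  }
  where open Exchange ex

at-diff : ∀ {n} → Subset n → Subset n → ℕ → Bool
at-diff X Y j = at X j ∧ not (at Y j)

symdiff-halves : ∀ {n} (X Y : Subset n) → ∣ X ∣ ≡ ∣ Y ∣ → Adjacent X Y →
  count (at-diff X Y) n ≡ 1 × count (at-diff Y X) n ≡ 1
symdiff-halves {n} X Y |X|≡|Y| X~Y = X∖Y≡1 , trans (sym X∖Y≡Y∖X) X∖Y≡1
  where
  both X∖Y Y∖X : ℕ
  both = count (λ j → at X j ∧ at Y j) n
  X∖Y  = count (at-diff X Y) n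
  Y∖X  = count (at-diff Y X) n
  split-X : ∀ x y → bit x ≡ bit (x ∧ y) + bit (x ∧ not y)
  split-X true  true  = refl
  split-X true  false = refl
  split-X false _     = refl
  split-Y : ∀ x y → bit y ≡ bit (x ∧ y) + bit (y ∧ not x)
  split-Y true  true  = refl
  split-Y true  false = refl
  split-Y false true  = refl
  split-Y false false = refl
  split-xor : ∀ x y → bit (x xor y) ≡ bit (x ∧ not y) + bit (y ∧ not x)
  split-xor true  true  = refl
  split-xor true  false = refl
  split-xor false true  = refl
  split-xor false false = refl
  X∖Y≡Y∖X : X∖Y ≡ Y∖X
  X∖Y≡Y∖X = +-cancelˡ-≡ both X∖Y Y∖X (begin
    both + X∖Y      ≡⟨ sym (count-sum _ _ _ n (λ j _ → split-X (at X j) (at Y j))) ⟩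
    count (at X) n  ≡⟨ sym (card-count X) ⟩
    ∣ X ∣           ≡⟨ |X|≡|Y| ⟩
    ∣ Y ∣           ≡⟨ card-count Y ⟩
    count (at Y) n  ≡⟨ count-sum _ _ _ n (λ j _ → split-Y (at X j) (at Y j)) ⟩
    both + Y∖X      ∎)
    where open ≡-Reasoning
  X∖Y≡1 : X∖Y ≡ 1
  X∖Y≡1 = +-double-injective X∖Y 1 (begin
    X∖Y + X∖Y                         ≡⟨ cong (X∖Y +_) X∖Y≡Y∖X ⟩
    X∖Y + Y∖X                         ≡⟨ sym (count-sum _ _ _ n (λ j _ → split-xor (at X j) (at Y j))) ⟩
    count (λ j → at X j xor at Y j) n ≡⟨ sym (card-symdiff X Y) ⟩
    ∣ (X ─ Y) ∪ (Y ─ X) ∣             ≡⟨ X~Y ⟩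
    2                                 ∎)
    where open ≡-Reasoning

count≡1-unique : ∀ p {k a j} → count p k ≡ 1 → a < k → j < k → p a ≡ true → p j ≡ true → j ≡ a
count≡1-unique p {a = a} {j} c≡1 a<k j<k pa pj with <-cmp a j
... | tri< a<j _ _ = contradiction (≤-trans (count-≥2 p a<j j<k pa pj) (≤-reflexive c≡1)) (1+n≰n {1})
... | tri≈ _ a≡j _ = sym a≡j
... | tri> _ _ j<a = contradiction (≤-trans (count-≥2 p j<a a<k pj pa) (≤-reflexive c≡1)) (1+n≰n {1})

adjacent⇒exchange : ∀ {n} (X Y : Subset n) → ∣ X ∣ ≡ ∣ Y ∣ → Adjacent X Y → Exchange X Y
adjacent⇒exchange {n} X Y |X|≡|Y| X~Y with symdiff-halves X Y |X|≡|Y| X~Y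
... | X∖Y≡1 , Y∖X≡1
  with count-min (at-diff X Y) n (≤-reflexive (sym X∖Y≡1))
     | count-min (at-diff Y X) n (≤-reflexive (sym Y∖X≡1))
... | e , e<n , pe , _ | f , f<n , pf , _ = record
  { out = e ; new = f ; out<n = e<n ; new<n = f<n
  ; out∈X = left pe ; out∉Y = not-right pe ; new∉X = not-right pf ; new∈Y = left pf
  ; agree = agree }
  where
  left : ∀ {x y} → x ∧ not y ≡ true → x ≡ true
  left {true} _ = refl
  not-right : ∀ {x y} → x ∧ not y ≡ true → y ≡ false
  not-right {true} {false} _ = refl
  agree : ∀ j → j ≢ e → j ≢ f → at X j ≡ at Y j
  agree j j≢e j≢f with n ≤? j
  ... | yes n≤j = trans (at-beyond X n≤j) (sym (at-beyond Y n≤j))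
  ... | no  n≰j with at X j in Xj | at Y j in Yj
  ...   | true  | true  = refl
  ...   | false | false = refl
  ...   | true  | false = contradiction
    (count≡1-unique (at-diff X Y) X∖Y≡1 e<n (≰⇒> n≰j) pe (cong₂ _∧_ Xj (cong not Yj))) j≢e
  ...   | false | true  = contradiction
    (count≡1-unique (at-diff Y X) Y∖X≡1 f<n (≰⇒> n≰j) pf (cong₂ _∧_ Yj (cong not Xj))) j≢f

update : ∀ {n} → Subset n → ℕ → Bool → Subset n
update []      _       _ = []
update (x ∷ X) zero    b = b ∷ X
update (x ∷ X) (suc i) b = x ∷ update X i b

at-update-same : ∀ {n} (X : Subset n) {i} b → i < n → at (update X i b) i ≡ b
at-update-same (x ∷ X) {zero}  b _         = refl
at-update-same (x ∷ X) {suc i} b (s≤s i<n) = at-update-same X b i<n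

at-update-other : ∀ {n} (X : Subset n) {i} b {j} → i ≢ j → at (update X i b) j ≡ at X j
at-update-other []      b               _   = refl
at-update-other (x ∷ X) {zero}  b {zero}  i≢j = contradiction refl i≢j
at-update-other (x ∷ X) {zero}  b {suc j} _   = refl
at-update-other (x ∷ X) {suc i} b {zero}  _   = refl
at-update-other (x ∷ X) {suc i} b {suc j} i≢j = at-update-other X b (i≢j ∘′ cong suc)

move : ∀ {n} → Subset n → ℕ → ℕ → Subset n
move X g h = update (update X g false) h true

at-move-from : ∀ {n} (X : Subset n) {g h} → g < n → g ≢ h → at (move X g h) g ≡ false
at-move-from X {g} g<n g≢h =
  trans (at-update-other (update X g false) true (g≢h ∘′ sym)) (at-update-same X false g<n)

at-move-to : ∀ {n} (X : Subset n) {g h} → h < n → at (move X g h) h ≡ true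
at-move-to X {g} h<n = at-update-same (update X g false) true h<n

at-move-other : ∀ {n} (X : Subset n) {g h j} → j ≢ g → j ≢ h → at (move X g h) j ≡ at X j
at-move-other X {g} j≢g j≢h =
  trans (at-update-other (update X g false) true (j≢h ∘′ sym))
        (at-update-other X false (j≢g ∘′ sym))

move-exchange : ∀ {n} (X : Subset n) {g h} → g < n → h < n → at X g ≡ true → at X h ≡ false →
  Exchange X (move X g h)
move-exchange X {g} {h} g<n h<n Xg Xh = record
  { out = g ; new = h ; out<n = g<n ; new<n = h<n
  ; out∈X = Xg ; out∉Y = at-move-from X g<n g≢h ; new∉X = Xh ; new∈Y = at-move-to X h<n
  ; agree = λ j j≢g j≢h → sym (at-move-other X j≢g j≢h) }
  where
  g≢h = member≢nonmember {X = X} Xg Xh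

below-count : ∀ {n} (X Q : Subset n) → NeverAbove X Q → ∀ k → count (at X) k ≤ count (at Q) k
below-count X Q X≤Q k = subst₂ _≤_ (prefixN-count X k) (prefixN-count Q k) (X≤Q k)

-- Moving the N step at g to h changes the prefix counts by +1 on (h, g] and by -1 on (g, h].
move-basis : ∀ {m r} (Q X : Subset (m + r)) {g h} → g < m + r → h < m + r →
  at X g ≡ true → at X h ≡ false → IsBasis m r Q X →
  (∀ k → h < k → k ≤ g → count (at X) k < count (at Q) k) → IsBasis m r Q (move X g h)
move-basis {m} {r} Q X {g} {h} g<n h<n Xg Xh (X-path , X≤Q) slack = Y-path , Y≤Q
  where
  n = m + r
  Y = move X g h
  open Exchange (move-exchange X g<n h<n Xg Xh) using (count-exchange)
  balance : ∀ k {a b} → count (point g) k ≡ a → count (point h) k ≡ b →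
    count (at Y) k + a ≡ count (at X) k + b
  balance k refl refl = count-exchange k
  count-Y≤Q : ∀ k → count (at Y) k ≤ count (at Q) k
  count-Y≤Q k with h <? k | g <? k
  ... | no h≮k | _ = begin
    count (at Y) k                      ≤⟨ m≤m+n _ _ ⟩
    count (at Y) k + count (point g) k  ≡⟨ balance k refl (count-point-≤ h k (≮⇒≥ h≮k)) ⟩
    count (at X) k + 0                  ≡⟨ +-identityʳ _ ⟩
    count (at X) k                      ≤⟨ below-count X Q X≤Q k ⟩
    count (at Q) k                      ∎
    where open ≤-Reasoning
  ... | yes h<k | yes g<k = begin
    count (at Y) k  ≡⟨ +-cancelʳ-≡ 1 _ _ (balance k (count-point-< g k g<k) (count-point-< h k h<k)) ⟩
    count (at X) k  ≤⟨ below-count X Q X≤Q k ⟩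
    count (at Q) k  ∎
    where open ≤-Reasoning
  ... | yes h<k | no g≮k = begin
    count (at Y) k      ≡⟨ sym (+-identityʳ _) ⟩
    count (at Y) k + 0  ≡⟨ balance k (count-point-≤ g k (≮⇒≥ g≮k)) (count-point-< h k h<k) ⟩
    count (at X) k + 1  ≡⟨ +-comm _ 1 ⟩
    suc (count (at X) k) ≤⟨ slack k h<k (≮⇒≥ g≮k) ⟩
    count (at Q) k      ∎
    where open ≤-Reasoning
  Y-path : ∣ Y ∣ ≡ r
  Y-path = begin
    ∣ Y ∣           ≡⟨ card-count Y ⟩
    count (at Y) n  ≡⟨ +-cancelʳ-≡ 1 _ _ (balance n (count-point-< g n g<n) (count-point-< h n h<n)) ⟩
    count (at X) n  ≡⟨ sym (card-count X) ⟩
    ∣ X ∣           ≡⟨ X-path ⟩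
    r               ∎
    where open ≡-Reasoning
  Y≤Q : NeverAbove Y Q
  Y≤Q k = subst₂ _≤_ (sym (prefixN-count Y k)) (sym (prefixN-count Q k)) (count-Y≤Q k)

no-loop⇒starts-N : ∀ {m r} (Q : Subset (m + r)) → ¬ HasLoop m r Q → 0 < m + r → at Q 0 ≡ true
no-loop⇒starts-N {m} {r} Q no-loop 0<n with at Q 0 in Q0
... | true  = refl
... | false = contradiction (fromℕ< 0<n , 0∉basis) no-loop
  where
  0∉basis : ∀ B → IsBasis m r Q B → fromℕ< 0<n ∉ B
  0∉basis B (_ , B≤Q) = at⇒∉ B _ (subst (λ i → at B i ≡ false) (sym (toℕ-fromℕ< 0<n)) B0)
    where
    B0 : at B 0 ≡ false
    B0 = ¬-not λ B0≡true → 1+n≰n {0} (≤-trans (count-≥1 (at B) {k = 1} (s≤s z≤n) B0≡true)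
      (subst (count (at B) 1 ≤_) (cong bit Q0) (below-count B Q B≤Q 1)))

no-isthmus⇒ends-E : ∀ {m r} (Q : Subset (m + r)) → IsPath m r Q → ¬ HasIsthmus m r Q →
  ∀ {L} → suc L ≡ m + r → at Q L ≡ false
no-isthmus⇒ends-E {m} {r} Q Q-path no-isthmus {L} 1+L≡n with at Q L in QL
... | false = refl
... | true  = contradiction (fromℕ< L<n , L∈basis) no-isthmus
  where
  L<n : L < m + r
  L<n = subst (L <_) 1+L≡n ≤-refl
  total : ∀ X → ∣ X ∣ ≡ r → count (at X) L + bit (at X L) ≡ r
  total X X-path = trans (cong (count (at X)) 1+L≡n) (trans (sym (card-count X)) X-path)
  L∈basis : ∀ B → IsBasis m r Q B → fromℕ< L<n ∈ B
  L∈basis B (B-path , B≤Q) = at⇒∈ B _ (subst (λ i → at B i ≡ true) (sym (toℕ-fromℕ< L<n)) BL)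
    where
    BL : at B L ≡ true
    BL = ¬-not λ BL≡false → 1+n≰n (begin
      suc (count (at Q) L)           ≡⟨ +-comm 1 _ ⟩
      count (at Q) L + bit true      ≡⟨ cong (λ b → count (at Q) L + bit b) (sym QL) ⟩
      count (at Q) L + bit (at Q L)  ≡⟨ total Q Q-path ⟩
      r                              ≡⟨ sym (total B B-path) ⟩
      count (at B) L + bit (at B L)  ≡⟨ cong (λ b → count (at B) L + bit b) BL≡false ⟩
      count (at B) L + 0             ≡⟨ +-identityʳ _ ⟩
      count (at B) L                 ≤⟨ below-count B Q B≤Q L ⟩
      count (at Q) L                 ∎)
      where open ≤-Reasoning

∃-between? : ∀ {P : ℕ → Set} → (∀ k → Dec (P k)) → ∀ a b →
  Dec (∃[ k ] (a < k × k ≤ b × P k))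
∃-between? P? a zero    = no λ (k , a<k , k≤0 , _) → n≮0 (<-≤-trans a<k k≤0)
∃-between? {P} P? a (suc b) =
  map′ to from (∃-between? P? a b ⊎-dec (a <? suc b ×-dec P? (suc b)))
  where
  to : (∃[ k ] (a < k × k ≤ b × P k)) ⊎ (a < suc b × P (suc b)) →
    ∃[ k ] (a < k × k ≤ suc b × P k)
  to (inj₁ (k , a<k , k≤b , Pk)) = k , a<k , m≤n⇒m≤1+n k≤b , Pk
  to (inj₂ (a<1+b , P1+b))       = suc b , a<1+b , ≤-refl , P1+b
  from : ∃[ k ] (a < k × k ≤ suc b × P k) →
    (∃[ k ] (a < k × k ≤ b × P k)) ⊎ (a < suc b × P (suc b))
  from (k , a<k , k≤1+b , Pk) with m≤n⇒m<n∨m≡n k≤1+b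
  ... | inj₁ k<1+b = inj₁ (k , a<k , ≤-pred k<1+b , Pk)
  ... | inj₂ refl  = inj₂ (a<k , Pk)

collect : ∀ {A : Set} → (ℕ → Bool) → (ℕ → A) → ℕ → List A
collect p F zero    = []
collect p F (suc k) = if p k then F k ∷ collect p F k else collect p F k

length-collect : ∀ {A : Set} p (F : ℕ → A) k → length (collect p F k) ≡ count p k
length-collect p F zero    = refl
length-collect p F (suc k) with p k
... | true  = trans (cong suc (length-collect p F k)) (+-comm 1 _)
... | false = trans (length-collect p F k) (sym (+-identityʳ _))

collect-all : ∀ {A : Set} {P : A → Set} p (F : ℕ → A) k →
  (∀ j → j < k → p j ≡ true → P (F j)) → All P (collect p F k)
collect-all p F zero    _  = []
collect-all p F (suc k) PF with p k in pk
... | true  = PF k ≤-refl pk ∷ collect-all p F k (restrict PF)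
... | false = collect-all p F k (restrict PF)

collect-unique : ∀ {A : Set} p (F : ℕ → A) k →
  (∀ i j → i < j → j < k → p i ≡ true → p j ≡ true → F j ≢ F i) → Unique (collect p F k)
collect-unique p F zero    _     = []
collect-unique p F (suc k) F-inj with p k in pk
... | true  = collect-all p F k (λ i i<k pi → F-inj i k i<k ≤-refl pi pk)
            ∷ collect-unique p F k λ i j i<j j<k → F-inj i j i<j (m<n⇒m<1+n j<k)
... | false = collect-unique p F k λ i j i<j j<k → F-inj i j i<j (m<n⇒m<1+n j<k)

tails-E-equal : ∀ {n} (X Q : Subset n) → ∣ X ∣ ≡ ∣ Q ∣ → ∀ {k} → k ≤ n →
  count (at X) k ≡ count (at Q) k →
  countFrom (λ j → not (at X j)) k n ≡ countFrom (λ j → not (at Q j)) k n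
tails-E-equal {n} X Q |X|≡|Q| {k} k≤n tight =
  +-cancelˡ-≡ (countFrom (at X) k n) _ _ (begin
    countFrom (at X) k n + countFrom (λ j → not (at X j)) k n ≡⟨ count-complement _ (n ∸ k) ⟩
    n ∸ k                                                   ≡⟨ sym (count-complement _ (n ∸ k)) ⟩
    countFrom (at Q) k n + countFrom (λ j → not (at Q j)) k n ≡⟨ cong (_+ _) (sym N-tails) ⟩
    countFrom (at X) k n + countFrom (λ j → not (at Q j)) k n ∎)
  where
  open ≡-Reasoning
  N-tails : countFrom (at X) k n ≡ countFrom (at Q) k n
  N-tails = +-cancelˡ-≡ (count (at X) k) _ _ (begin
    count (at X) k + countFrom (at X) k n ≡⟨ sym (count-split (at X) k≤n) ⟩
    count (at X) n                        ≡⟨ sym (card-count X) ⟩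
    ∣ X ∣                                 ≡⟨ |X|≡|Q| ⟩
    ∣ Q ∣                                 ≡⟨ card-count Q ⟩
    count (at Q) n                        ≡⟨ count-split (at Q) k≤n ⟩
    count (at Q) k + countFrom (at Q) k n ≡⟨ cong (_+ _) (sym tight) ⟩
    count (at X) k + countFrom (at Q) k n ∎)

move-both : ∀ {n} {X Y : Subset n} (ex : Exchange X Y) {g h} → g < n → h < n →
  at X g ≡ true → at Y g ≡ true → at X h ≡ false → at Y h ≡ false →
  Exchange (move X g h) (move Y g h)
move-both {X = X} {Y} ex {g} {h} g<n h<n Xg Yg Xh Yh = record
  { out = out ; new = new ; out<n = out<n ; new<n = new<n
  ; out∈X = trans (at-move-other X out≢g out≢h) out∈X
  ; out∉Y = trans (at-move-other Y out≢g out≢h) out∉Y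
  ; new∉X = trans (at-move-other X new≢g new≢h) new∉X
  ; new∈Y = trans (at-move-other Y new≢g new≢h) new∈Y
  ; agree = agree′ }
  where
  open Exchange ex
  g≢h = member≢nonmember {X = X} Xg Xh
  out≢g = member≢nonmember {X = Y} Yg out∉Y ∘′ sym
  out≢h = member≢nonmember {X = X} out∈X Xh
  new≢g = member≢nonmember {X = X} Xg new∉X ∘′ sym
  new≢h = member≢nonmember {X = Y} new∈Y Yh
  agree′ : ∀ j → j ≢ out → j ≢ new → at (move X g h) j ≡ at (move Y g h) j
  agree′ j j≢out j≢new with j ≟ g | j ≟ h
  ... | yes refl | _        = trans (at-move-from X g<n g≢h) (sym (at-move-from Y g<n g≢h))
  ... | no  j≢g  | yes refl = trans (at-move-to X h<n) (sym (at-move-to Y h<n))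
  ... | no  j≢g  | no  j≢h  =
    trans (at-move-other X j≢g j≢h) (trans (agree j j≢out j≢new) (sym (at-move-other Y j≢g j≢h)))

move-retarget : ∀ {n} (X : Subset n) {g h h'} → g < n → h < n → h' < n →
  at X g ≡ true → at X h ≡ false → at X h' ≡ false → h ≢ h' →
  Exchange (move X g h) (move X g h')
move-retarget X {g} {h} {h'} g<n h<n h'<n Xg Xh Xh' h≢h' = record
  { out = h ; new = h' ; out<n = h<n ; new<n = h'<n
  ; out∈X = at-move-to X h<n
  ; out∉Y = trans (at-move-other X (g≢h ∘′ sym) h≢h') Xh
  ; new∉X = trans (at-move-other X (g≢h' ∘′ sym) (h≢h' ∘′ sym)) Xh'
  ; new∈Y = at-move-to X h'<n
  ; agree = agree }
  where
  g≢h  = member≢nonmember {X = X} Xg Xh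
  g≢h' = member≢nonmember {X = X} Xg Xh'
  agree : ∀ j → j ≢ h → j ≢ h' → at (move X g h) j ≡ at (move X g h') j
  agree j j≢h j≢h' with j ≟ g
  ... | yes refl = trans (at-move-from X g<n g≢h) (sym (at-move-from X g<n g≢h'))
  ... | no  j≢g  = trans (at-move-other X j≢g j≢h) (sym (at-move-other X j≢g j≢h'))

GoodCycles : (m r : ℕ) (Q B1 B2 : Subset (m + r)) → Set
GoodCycles m r Q B1 B2 = Σ (List (Subset (m + r) × Subset (m + r))) λ cs →
  Unique cs × All (λ c → GoodCycle m r Q B1 B2 (proj₁ c) (proj₂ c)) cs × r ∸ 1 ≤ length cs

module Cycles {m r : ℕ} (Q B1 B2 : Subset (m + r)) (Q-path : IsPath m r Q) (2≤r : 2 ≤ r) (r≤m : r ≤ m)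
  {L : ℕ} (1+L≡n : suc L ≡ m + r) (Q-starts-N : at Q 0 ≡ true) (Q-ends-E : at Q L ≡ false)
  (B1-basis : IsBasis m r Q B1) (B2-basis : IsBasis m r Q B2) (ex : Exchange B1 B2)
  where

  open Exchange ex using (only-out; count-exchange; count-both; count-either)
    renaming (out to e; new to f; out<n to e<n; new<n to f<n; out∈X to e∈B1; out∉Y to e∉B2;
              new∉X to f∉B1; new∈Y to f∈B2; agree to B1≈B2; X≢Y to B1≢B2; out≢new to e≢f)

  n : ℕ
  n = m + r

  q b1 b2 : ℕ → ℕ
  q  = count (at Q)
  b1 = count (at B1)
  b2 = count (at B2)

  b1≤q : ∀ k → b1 k ≤ q k
  b1≤q = below-count B1 Q (proj₂ B1-basis)

  b2≤q : ∀ k → b2 k ≤ q k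
  b2≤q = below-count B2 Q (proj₂ B2-basis)

  Tight : Subset n → ℕ → Set
  Tight X k = count (at X) k ≡ q k

  tight? : ∀ X k → Dec (Tight X k)
  tight? X k = count (at X) k ≟ q k

  b2+[e<k]≡b1 : ∀ k → k ≤ f → b2 k + count (point e) k ≡ b1 k
  b2+[e<k]≡b1 k k≤f =
    trans (count-exchange k) (trans (cong (b1 k +_) (count-point-≤ f k k≤f)) (+-identityʳ _))

  b2≤b1 : ∀ k → k ≤ f → b2 k ≤ b1 k
  b2≤b1 k k≤f = ≤-trans (m≤m+n _ _) (≤-reflexive (b2+[e<k]≡b1 k k≤f))

  b2<b1 : ∀ k → e < k → k ≤ f → b2 k < b1 k
  b2<b1 k e<k k≤f = ≤-reflexive (trans (+-comm 1 _)
    (trans (cong (b2 k +_) (sym (count-point-< e k e<k))) (b2+[e<k]≡b1 k k≤f)))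

  common outside : ℕ → Bool
  common  j = at B1 j ∧ at B2 j
  outside j = not (at B1 j ∨ at B2 j)

  b1-total : b1 n ≡ r
  b1-total = trans (sym (card-count B1)) (proj₁ B1-basis)

  count-common : count common n + 1 ≡ r
  count-common = begin
    count common n + 1                 ≡⟨ cong (count common n +_) (sym (count-point-< e n e<n)) ⟩
    count common n + count (point e) n ≡⟨ sym (count-both n) ⟩
    b1 n                               ≡⟨ b1-total ⟩
    r                                  ∎
    where open ≡-Reasoning

  count-outside : count outside n + 1 ≡ m
  count-outside = +-cancelʳ-≡ r _ _ (begin
    (count outside n + 1) + r                          ≡⟨ +-assoc _ 1 r ⟩
    count outside n + suc r                            ≡⟨ +-comm _ (suc r) ⟩
    suc r + count outside n                            ≡⟨ cong (_+ count outside n) (sym union) ⟩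
    count (λ j → at B1 j ∨ at B2 j) n + count outside n ≡⟨ count-complement _ n ⟩
    m + r                                              ∎)
    where
    open ≡-Reasoning
    union : count (λ j → at B1 j ∨ at B2 j) n ≡ suc r
    union = trans (count-either n) (trans (cong₂ _+_ b1-total (count-point-< f n f<n)) (+-comm r 1))

  L<n : L < n
  L<n = subst (L <_) 1+L≡n ≤-refl

  Q-tail-has-E : ∀ {k} → k < n → 1 ≤ countFrom (λ j → not (at Q j)) k n
  Q-tail-has-E {k} k<n =
    countFrom-≥1 (λ j → not (at Q j)) (≤-pred (subst (k <_) (sym 1+L≡n) k<n)) L<n (cong not Q-ends-E)

  not-tight-before-only-N : ∀ X {k} → ∣ X ∣ ≡ r → k < n → (∀ j → k ≤ j → j < n → at X j ≡ true) →
    ¬ Tight X k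
  not-tight-before-only-N X {k} X-path k<n only-N tight = 1+n≰n {0} (begin
    1                                         ≤⟨ Q-tail-has-E k<n ⟩
    countFrom (λ j → not (at Q j)) k n
      ≡⟨ sym (tails-E-equal X Q (trans X-path (sym Q-path)) (<⇒≤ k<n) tight) ⟩
    countFrom (λ j → not (at X j)) k n
      ≡⟨ countFrom-none _ (λ j k≤j j<n → cong not (only-N j k≤j j<n)) ⟩
    0                                         ∎)
    where open ≤-Reasoning

  good-cycle : ∀ {B3 B4} → IsBasis m r Q B3 → IsBasis m r Q B4 →
    Exchange B2 B3 → Exchange B3 B4 → Exchange B4 B1 → B1 ≢ B4 →
    at B3 e ≡ false → at B4 e ≡ true → GoodCycle m r Q B1 B2 B3 B4
  good-cycle {B3} {B4} B3-basis B4-basis ex23 ex34 ex41 B1≢B4 e∉B3 e∈B4 =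
    B3-basis , B4-basis , B1≢B2 , ≢-at e (true≢false e∈B1 e∉B3) , B1≢B4 , Exchange.X≢Y ex23 ,
    ≢-at e (true≢false e∈B4 e∉B2 ∘′ sym) , Exchange.X≢Y ex34 ,
    Exchange.adjacent ex23 , Exchange.adjacent ex34 , Exchange.adjacent ex41 , e-condition
    where
    e-condition : ∀ x → x ∈ B1 → x ∉ B2 → x ∈ B4 × x ∉ B3
    e-condition x x∈B1 x∉B2 =
      at⇒∈ B4 x (subst (λ i → at B4 i ≡ true) (sym x≡e) e∈B4) ,
      at⇒∉ B3 x (subst (λ i → at B3 i ≡ false) (sym x≡e) e∉B3)
      where
      x≡e : toℕ x ≡ e
      x≡e = only-out (∈⇒at x∈B1) (¬-not (x∉B2 ∘′ at⇒∈ B2 x))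

  module _ {g h : ℕ} (g<n : g < n) (h<n : h < n)
    (g∈B1 : at B1 g ≡ true) (g∈B2 : at B2 g ≡ true)
    (h∉B1 : at B1 h ≡ false) (h∉B2 : at B2 h ≡ false)
    where

    private
      g≢h = member≢nonmember {X = B1} g∈B1 h∉B1
      e≢g = member≢nonmember {X = B2} g∈B2 e∉B2 ∘′ sym
      e≢h = member≢nonmember {X = B1} e∈B1 h∉B1
      f≢g = member≢nonmember {X = B1} g∈B1 f∉B1 ∘′ sym
      f≢h = member≢nonmember {X = B2} f∈B2 h∉B2
      e∉B3 : ∀ {x} → x ≢ e → at (move B2 x h) e ≡ false
      e∉B3 x≢e = trans (at-move-other B2 (x≢e ∘′ sym) e≢h) e∉B2
      B1≢B4 : B1 ≢ move B1 g h
      B1≢B4 = ≢-at g (true≢false g∈B1 (at-move-from B1 g<n g≢h))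
      ex41 : Exchange (move B1 g h) B1
      ex41 = exchange-sym (move-exchange B1 g<n h<n g∈B1 h∉B1)

    cycle-moving-both : IsBasis m r Q (move B2 g h) → IsBasis m r Q (move B1 g h) →
      GoodCycle m r Q B1 B2 (move B2 g h) (move B1 g h)
    cycle-moving-both B3-basis B4-basis = good-cycle B3-basis B4-basis
      (move-exchange B2 g<n h<n g∈B2 h∉B2)
      (move-both (exchange-sym ex) g<n h<n g∈B2 g∈B1 h∉B2 h∉B1)
      ex41 B1≢B4 (e∉B3 (e≢g ∘′ sym)) (trans (at-move-other B1 e≢g e≢h) e∈B1)

    cycle-retargeting : IsBasis m r Q (move B2 g h) → IsBasis m r Q (move B2 g e) →
      GoodCycle m r Q B1 B2 (move B2 g h) (move B2 g e)
    cycle-retargeting B3-basis B4-basis = good-cycle B3-basis B4-basis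
      (move-exchange B2 g<n h<n g∈B2 h∉B2)
      (move-retarget B2 g<n h<n e<n g∈B2 h∉B2 e∉B2 (e≢h ∘′ sym))
      ex41′ (≢-at g (true≢false g∈B1 (at-move-from B2 g<n (e≢g ∘′ sym))))
      (e∉B3 (e≢g ∘′ sym)) (at-move-to B2 e<n)
      where
      ex41′ : Exchange (move B2 g e) B1
      ex41′ = record
        { out = f ; new = g ; out<n = f<n ; new<n = g<n
        ; out∈X = trans (at-move-other B2 f≢g (e≢f ∘′ sym)) f∈B2 ; out∉Y = f∉B1
        ; new∉X = at-move-from B2 g<n (e≢g ∘′ sym) ; new∈Y = g∈B1
        ; agree = agree }
        where
        agree : ∀ j → j ≢ f → j ≢ g → at (move B2 g e) j ≡ at B1 j
        agree j j≢f j≢g with j ≟ e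
        ... | yes refl = trans (at-move-to B2 e<n) (sym e∈B1)
        ... | no  j≢e  = trans (at-move-other B2 j≢g j≢e) (sym (B1≈B2 j j≢e j≢f))

    cycle-moving-f : IsBasis m r Q (move B2 f h) → IsBasis m r Q (move B1 g h) →
      GoodCycle m r Q B1 B2 (move B2 f h) (move B1 g h)
    cycle-moving-f B3-basis B4-basis = good-cycle B3-basis B4-basis
      (move-exchange B2 f<n h<n f∈B2 h∉B2) ex34 ex41 B1≢B4
      (e∉B3 (e≢f ∘′ sym)) (trans (at-move-other B1 e≢g e≢h) e∈B1)
      where
      ex34 : Exchange (move B2 f h) (move B1 g h)
      ex34 = record
        { out = g ; new = e ; out<n = g<n ; new<n = e<n
        ; out∈X = trans (at-move-other B2 (f≢g ∘′ sym) (g≢h)) g∈B2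
        ; out∉Y = at-move-from B1 g<n g≢h
        ; new∉X = e∉B3 (e≢f ∘′ sym)
        ; new∈Y = trans (at-move-other B1 e≢g e≢h) e∈B1
        ; agree = agree }
        where
        agree : ∀ j → j ≢ g → j ≢ e → at (move B2 f h) j ≡ at (move B1 g h) j
        agree j j≢g j≢e with j ≟ h | j ≟ f
        ... | yes refl | _        = trans (at-move-to B2 h<n) (sym (at-move-to B1 h<n))
        ... | no  j≢h  | yes refl =
          trans (at-move-from B2 f<n f≢h) (sym (trans (at-move-other B1 j≢g j≢h) f∉B1))
        ... | no  j≢h  | no  j≢f  =
          trans (at-move-other B2 j≢f j≢h)
                (trans (sym (B1≈B2 j j≢e j≢f)) (sym (at-move-other B1 j≢g j≢h)))

  good-cycles : (p : ℕ → Bool) (F : ℕ → Subset n × Subset n) →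
    (∀ j → j < n → p j ≡ true → GoodCycle m r Q B1 B2 (proj₁ (F j)) (proj₂ (F j))) →
    (∀ i j → i < j → j < n → p i ≡ true → p j ≡ true → F j ≢ F i) →
    r ∸ 1 ≤ count p n → GoodCycles m r Q B1 B2
  good-cycles p F good distinct enough =
    collect p F n , collect-unique p F n distinct , collect-all p F n good ,
    subst (r ∸ 1 ≤_) (sym (length-collect p F n)) enough

  module Pivots {gmin hmax : ℕ}
    (gmin<n : gmin < n) (gmin-common : common gmin ≡ true)
    (gmin-first : ∀ i → i < gmin → common i ≡ false)
    (hmax<n : hmax < n) (hmax-outside : outside hmax ≡ true)
    (hmax-last : ∀ j → hmax < j → j < n → outside j ≡ false)
    where

    gmin∈B1 : at B1 gmin ≡ true
    gmin∈B1 = proj₁ (∧-true gmin-common)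

    gmin∈B2 : at B2 gmin ≡ true
    gmin∈B2 = proj₂ (∧-true gmin-common)

    hmax∉B1 : at B1 hmax ≡ false
    hmax∉B1 = proj₁ (nor-true hmax-outside)

    hmax∉B2 : at B2 hmax ≡ false
    hmax∉B2 = proj₂ (nor-true {at B1 hmax} hmax-outside)

    before-gmin : ∀ {i} → i < gmin → at B1 i ≡ true → i ≡ e
    before-gmin {i} i<gmin B1i = only-out B1i (¬-not λ B2i →
      contradiction (trans (sym (gmin-first i i<gmin)) (cong₂ _∧_ B1i B2i)) λ ())

    after-hmax : ∀ {j} → hmax < j → j < n → at B1 j ≡ false → at B2 j ≡ false → ⊥
    after-hmax {j} hmax<j j<n B1j B2j =
      contradiction (trans (sym (hmax-last j hmax<j j<n)) (cong₂ (λ x y → not (x ∨ y)) B1j B2j)) λ ()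

    after-hmax-B1 : ∀ {j} → hmax < j → j < n → at B1 j ≡ false → j ≡ f
    after-hmax-B1 hmax<j j<n B1j =
      Exchange.only-out (exchange-sym ex) (¬-not (after-hmax hmax<j j<n B1j)) B1j

    after-hmax-B2 : ∀ {j} → hmax < j → j < n → at B2 j ≡ false → j ≡ e
    after-hmax-B2 hmax<j j<n B2j = only-out (¬-not λ B1j → after-hmax hmax<j j<n B1j B2j) B2j

    tight-B1-after-hmax⇒≤f : ∀ {k} → hmax < k → k < n → Tight B1 k → k ≤ f
    tight-B1-after-hmax⇒≤f {k} hmax<k k<n tight = ≮⇒≥ λ f<k →
      not-tight-before-only-N B1 (proj₁ B1-basis) k<n (λ j k≤j j<n → ¬-not λ B1j →
        <⇒≢ (<-≤-trans f<k k≤j) (sym (after-hmax-B1 (<-≤-trans hmax<k k≤j) j<n B1j))) tight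

    B2-not-tight-after-e : ∀ {k} → hmax < k → e < k → k < n → ¬ Tight B2 k
    B2-not-tight-after-e {k} hmax<k e<k k<n =
      not-tight-before-only-N B2 (proj₁ B2-basis) k<n λ j k≤j j<n → ¬-not λ B2j →
        <⇒≢ (<-≤-trans e<k k≤j) (sym (after-hmax-B2 (<-≤-trans hmax<k k≤j) j<n B2j))

    module EarlyTight {k₀ : ℕ} (0<k₀ : 0 < k₀) (k₀≤gmin : k₀ ≤ gmin) (tight₀ : Tight B1 k₀) where

      q≤[e<k₀] : q k₀ ≤ count (point e) k₀
      q≤[e<k₀] = ≤-trans (≤-reflexive (sym tight₀)) (count-mono k₀ λ j j<k₀ B1j →
        subst (λ i → point e i ≡ true) (sym (before-gmin (<-≤-trans j<k₀ k₀≤gmin) B1j)) (point-self e))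

      e<k₀ : e < k₀
      e<k₀ = ≰⇒> λ k₀≤e → 1+n≰n {0} (begin
        1                    ≤⟨ count-≥1 (at Q) 0<k₀ Q-starts-N ⟩
        q k₀                 ≤⟨ q≤[e<k₀] ⟩
        count (point e) k₀   ≡⟨ count-point-≤ e k₀ k₀≤e ⟩
        0                    ∎)
        where open ≤-Reasoning

      e-is-E-in-Q : 0 < e → at Q e ≡ false
      e-is-E-in-Q 0<e = ¬-not λ Qe → 1+n≰n {1} (begin
        2                    ≤⟨ count-≥2 (at Q) 0<e e<k₀ Q-starts-N Qe ⟩
        q k₀                 ≤⟨ q≤[e<k₀] ⟩
        count (point e) k₀   ≤⟨ count-point-≤1 e k₀ ⟩
        1                    ∎)
        where open ≤-Reasoning

      B2-not-tight-after-hmax : ∀ {k} → hmax < k → k < n → ¬ Tight B2 k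
      B2-not-tight-after-hmax {k} hmax<k k<n tight with e <? k
      ... | yes e<k = B2-not-tight-after-e hmax<k e<k k<n tight
      -- From k on, Q has E steps at e and at L, whereas B2 misses only e.
      ... | no  e≮k = 1+n≰n {1} (begin
        2
          ≤⟨ countFrom-≥2 (λ j → not (at Q j)) k≤e e<L L<n
               (cong not (e-is-E-in-Q 0<e)) (cong not Q-ends-E) ⟩
        countFrom (λ j → not (at Q j)) k n
          ≡⟨ sym (tails-E-equal B2 Q (trans (proj₁ B2-basis) (sym Q-path)) (<⇒≤ k<n) tight) ⟩
        countFrom (λ j → not (at B2 j)) k n
          ≤⟨ countFrom-≤1 _ e (λ j k≤j j<n B2j →
               after-hmax-B2 (<-≤-trans hmax<k k≤j) j<n (not-true B2j)) ⟩
        1 ∎)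
        where
        open ≤-Reasoning
        k≤e : k ≤ e
        k≤e = ≮⇒≥ e≮k
        0<e : 0 < e
        0<e = ≤-trans (s≤s z≤n) (<-≤-trans hmax<k k≤e)
        e<L : e < L
        e<L = <-≤-trans (<-≤-trans e<k₀ k₀≤gmin) (≤-pred (subst (gmin <_) (sym 1+L≡n) gmin<n))

      B1-tight-between? : ∀ g → Dec (∃[ k ] (hmax < k × k ≤ g × Tight B1 k))
      B1-tight-between? = ∃-between? (tight? B1) hmax

      fourth : ∀ g → Dec (∃[ k ] (hmax < k × k ≤ g × Tight B1 k)) → Subset n
      fourth g (yes _) = move B2 g e
      fourth g (no  _) = move B1 g hmax

      B2-slack : ∀ {g} → g < n → ∀ k → hmax < k → k ≤ g → b2 k < q k
      B2-slack g<n k hmax<k k≤g =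
        ≤∧≢⇒< (b2≤q k) (B2-not-tight-after-hmax hmax<k (≤-<-trans k≤g g<n))

      cycle : ∀ {g} → g < n → at B1 g ≡ true → at B2 g ≡ true →
        (d : Dec (∃[ k ] (hmax < k × k ≤ g × Tight B1 k))) →
        GoodCycle m r Q B1 B2 (move B2 g hmax) (fourth g d)
      cycle g<n g∈B1 g∈B2 (no no-tight) =
        cycle-moving-both g<n hmax<n g∈B1 g∈B2 hmax∉B1 hmax∉B2
          (move-basis Q B2 g<n hmax<n g∈B2 hmax∉B2 B2-basis (B2-slack g<n))
          (move-basis Q B1 g<n hmax<n g∈B1 hmax∉B1 B1-basis λ k hmax<k k≤g →
            ≤∧≢⇒< (b1≤q k) λ tight → no-tight (k , hmax<k , k≤g , tight))
      cycle {g} g<n g∈B1 g∈B2 (yes (k' , hmax<k' , k'≤g , tight')) =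
        cycle-retargeting g<n hmax<n g∈B1 g∈B2 hmax∉B1 hmax∉B2
          (move-basis Q B2 g<n hmax<n g∈B2 hmax∉B2 B2-basis (B2-slack g<n))
          (move-basis Q B2 g<n e<n g∈B2 e∉B2 B2-basis slack)
        where
        k'≤f : k' ≤ f
        k'≤f = tight-B1-after-hmax⇒≤f hmax<k' (≤-<-trans k'≤g g<n) tight'
        slack : ∀ k → e < k → k ≤ g → b2 k < q k
        slack k e<k k≤g with hmax <? k
        ... | yes hmax<k = B2-slack g<n k hmax<k k≤g
        ... | no  hmax≮k =
          <-≤-trans (b2<b1 k e<k (≤-trans (≮⇒≥ hmax≮k) (≤-trans (<⇒≤ hmax<k') k'≤f))) (b1≤q k)

      pair : ℕ → Subset n × Subset n
      pair g = move B2 g hmax , fourth g (B1-tight-between? g)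

      cycles : GoodCycles m r Q B1 B2
      cycles = good-cycles common pair
        (λ g g<n g-common →
          cycle g<n (proj₁ (∧-true g-common)) (proj₂ (∧-true g-common)) (B1-tight-between? g))
        distinct
        (≤-reflexive (trans (cong (_∸ 1) (sym count-common)) (m+n∸n≡m _ 1)))
        where
        distinct : ∀ i j → i < j → j < n → common i ≡ true → common j ≡ true → pair j ≢ pair i
        distinct i j i<j j<n _ j-common eq =
          true≢false (trans (at-move-other B2 (<⇒≢ i<j ∘′ sym) j≢hmax) j∈B2)
                     (at-move-from B2 j<n j≢hmax)
                     (cong (λ c → at (proj₁ c) j) (sym eq))
          where
          j∈B2 = proj₂ (∧-true {at B1 j} j-common)
          j≢hmax = member≢nonmember {X = B2} j∈B2 hmax∉B2

    module NoEarlyTight (no-early : ∀ k → 0 < k → k ≤ gmin → ¬ Tight B1 k) where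

      B1-slack : ∀ {h} k → h < k → k ≤ gmin → b1 k < q k
      B1-slack k h<k k≤gmin = ≤∧≢⇒< (b1≤q k) (no-early k (≤-<-trans z≤n h<k) k≤gmin)

      B4-basis : ∀ {h} → h < n → at B1 h ≡ false → IsBasis m r Q (move B1 gmin h)
      B4-basis h<n h∉B1 = move-basis Q B1 gmin<n h<n gmin∈B1 h∉B1 B1-basis λ k h<k k≤gmin →
        B1-slack k h<k k≤gmin

      third : Dec (f < gmin) → ℕ → Subset n
      third (yes _) h = move B2 f h
      third (no  _) h = move B2 gmin h

      cycle : ∀ {h} → h < n → at B1 h ≡ false → at B2 h ≡ false → (d : Dec (f < gmin)) →
        GoodCycle m r Q B1 B2 (third d h) (move B1 gmin h)
      cycle h<n h∉B1 h∉B2 (yes f<gmin) =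
        cycle-moving-f gmin<n h<n gmin∈B1 gmin∈B2 h∉B1 h∉B2
          (move-basis Q B2 f<n h<n f∈B2 h∉B2 B2-basis λ k h<k k≤f →
            ≤-<-trans (b2≤b1 k k≤f) (B1-slack k h<k (≤-trans k≤f (<⇒≤ f<gmin))))
          (B4-basis h<n h∉B1)
      cycle h<n h∉B1 h∉B2 (no f≮gmin) =
        cycle-moving-both gmin<n h<n gmin∈B1 gmin∈B2 h∉B1 h∉B2
          (move-basis Q B2 gmin<n h<n gmin∈B2 h∉B2 B2-basis λ k h<k k≤gmin →
            ≤-<-trans (b2≤b1 k (≤-trans k≤gmin (≮⇒≥ f≮gmin))) (B1-slack k h<k k≤gmin))
          (B4-basis h<n h∉B1)

      pair : ℕ → Subset n × Subset n
      pair h = third (f <? gmin) h , move B1 gmin h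

      cycles : GoodCycles m r Q B1 B2
      cycles = good-cycles outside pair
        (λ h h<n h-outside →
          cycle h<n (proj₁ (nor-true h-outside)) (proj₂ (nor-true {at B1 h} h-outside)) (f <? gmin))
        distinct
        (≤-trans (∸-monoˡ-≤ 1 r≤m)
                 (≤-reflexive (trans (cong (_∸ 1) (sym count-outside)) (m+n∸n≡m _ 1))))
        where
        distinct : ∀ i j → i < j → j < n → outside i ≡ true → outside j ≡ true → pair j ≢ pair i
        distinct i j i<j j<n _ j-outside eq =
          true≢false (at-move-to B1 j<n) (trans (at-move-other B1 j≢gmin (<⇒≢ i<j ∘′ sym)) j∉B1)
            (cong (λ c → at (proj₂ c) j) eq)
          where
          j∉B1 = proj₁ (nor-true j-outside)
          j≢gmin = member≢nonmember {X = B1} gmin∈B1 j∉B1 ∘′ sym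

  cycles : GoodCycles m r Q B1 B2
  cycles with count-min common n (+-cancelʳ-≤ 1 1 _ (subst (2 ≤_) (sym count-common) 2≤r))
            | count-max outside n
                (+-cancelʳ-≤ 1 1 _ (subst (2 ≤_) (sym count-outside) (≤-trans 2≤r r≤m)))
  ... | gmin , gmin<n , gmin-common , gmin-first | hmax , hmax<n , hmax-outside , hmax-last
    with ∃-between? (tight? B1) 0 gmin
  ...   | yes (k₀ , 0<k₀ , k₀≤gmin , tight₀) =
    EarlyTight.cycles 0<k₀ k₀≤gmin tight₀
    where open Pivots gmin<n gmin-common gmin-first hmax<n hmax-outside hmax-last
  ...   | no  no-early =
    NoEarlyTight.cycles λ k 0<k k≤gmin tight → no-early (k , 0<k , k≤gmin , tight)
    where open Pivots gmin<n gmin-common gmin-first hmax<n hmax-outside hmax-last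

lemma3p1 : (m r : ℕ) (Q : Subset (m + r)) → IsPath m r Q →
    2 ≤ r → r ≤ m → ¬ HasLoop m r Q → ¬ HasIsthmus m r Q →
    (B1 B2 : Subset (m + r)) → IsBasis m r Q B1 → IsBasis m r Q B2 →
    Adjacent B1 B2 →
    Σ (List (Subset (m + r) × Subset (m + r))) λ cs →
      Unique cs × All (λ { (B3 , B4) → GoodCycle m r Q B1 B2 B3 B4 }) cs ×
      r ∸ 1 ≤ length cs
lemma3p1 m r Q Q-path 2≤r r≤m no-loop no-isthmus B1 B2 B1-basis B2-basis B1~B2 =
  Cycles.cycles Q B1 B2 Q-path 2≤r r≤m 1+L≡n
    (no-loop⇒starts-N Q no-loop 0<n) (no-isthmus⇒ends-E Q Q-path no-isthmus 1+L≡n)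
    B1-basis B2-basis (adjacent⇒exchange B1 B2 (trans (proj₁ B1-basis) (sym (proj₁ B2-basis))) B1~B2)
  where
  0<n : 0 < m + r
  0<n = ≤-trans (≤-trans (s≤s z≤n) 2≤r) (m≤n+m r m)
  1+L≡n : suc (m + r ∸ 1) ≡ m + r
  1+L≡n = trans (+-comm 1 _) (m∸n+n≡m 0<n)
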